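{- Let $\mathcal{A}$ be a submonoid of the monoid of endorelations on a set $A$ (under relational composition, with unit $1_A$). Then assigning to every relation $r\subseteq X\times Y$ the relation $\widehat{H}_A^{\mathcal{A}} r\subseteq X^A\times Y^A$ defined by $f\,(\widehat{H}_A^{\mathcal{A}}r)\,g$ iff there is $\phi\in\mathcal{A}$ with $\phi\le g^\circ\cdot r\cdot f$ defines a lax extension of $H_A=(-)^A$. Furthermore, (1) if $\mathcal{A}$ is closed under converses, then $\widehat{H}_A^{\mathcal{A}}$ preserves converses, and (2) if every relation in $\mathcal{A}$ is normal, then $\widehat{H}_A^{\mathcal{A}}$ is normal.
   Context: Relations $r\subseteq X\times Y$ are composed applicatively, $r^\circ$ is the converse, functions are regarded as relations, $1_X$ is the identity. $H_A\colon\mathbf{Set}\to\mathbf{Set}$ is the exponential functor $X\mapsto X^A$. Pointwise, $\phi\le g^\circ\cdot r\cdot f$ means $a\,\phi\,b\Rightarrow f(a)\,r\,g(b)$. A lax extension of a functor $F$ is a monotone assignment of $Lr\subseteq FX\times FY$ to each $r\subseteq X\times Y$ with $Ff\le Lf$, $(Ff)^\circ\le L(f^\circ)$ for all functions $f$ and $Ls\cdot Lr\le L(s\cdot r)$; it is normal if $L1_X=1_{FX}$ and preserves converses if $L(r^\circ)=(Lr)^\circ$. An endorelation $\phi\subseteq A\times A$ is normal if its difunctional closure (least relation of the form $g^\circ\cdot f$ containing it) is reflexive. -}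

module Defs where

open import Level using (Level; 0ℓ; suc)
open import Data.Product using (Σ; ∃; _×_; _,_)
open import Relation.Binary.PropositionalEquality using (_≡_)
open import Function using (flip; _∘_)

Rel' : Set → Set → Set₁
Rel' X Y = X → Y → Set

_⊆_ : ∀ {ℓ ℓ'} {X Y : Set} → (X → Y → Set ℓ) → (X → Y → Set ℓ') → Set (ℓ Level.⊔ ℓ')
r ⊆ s = ∀ {x y} → r x y → s x y

_≐_ : ∀ {ℓ ℓ'} {X Y : Set} → (X → Y → Set ℓ) → (X → Y → Set ℓ') → Set (ℓ Level.⊔ ℓ')
r ≐ s = (r ⊆ s) × (s ⊆ r)

infix 4 _⊆_ _≐_
infixr 9 _·_
infix 10 _°
-- Relational composition, applicative order: (s · r) = first r then s.
_·_ : ∀ {ℓ} {X Y Z : Set} → (Y → Z → Set ℓ) → (X → Y → Set ℓ) → X → Z → Set ℓ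
(s · r) x z = ∃ λ y → r x y × s y z

_° : ∀ {ℓ} {X Y : Set} → (X → Y → Set ℓ) → Y → X → Set ℓ
r ° = flip r

1R : (X : Set) → Rel' X X
1R X = _≡_

graph : {X Y : Set} → (X → Y) → Rel' X Y
graph f x y = f x ≡ y

H : (A : Set) → Set → Set
H A X = A → X

Hmap : {A X Y : Set} → (X → Y) → H A X → H A Y
Hmap f u = f ∘ u

-- Identity relation on H_A X = X^A: equality of functions, taken
-- pointwise (extensional), since Agda lacks function extensionality.
1H : (A X : Set) → H A X → H A X → Set
1H A X u v = ∀ a → u a ≡ v a

graphH : {A X Y : Set} → (X → Y) → H A X → H A Y → Set
graphH f u v = ∀ a → Hmap f u a ≡ v a

record IsSubmonoid {A : Set} (𝒜 : Rel' A A → Set₁) : Set₁ where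
  field
    unit : 𝒜 (1R A)
    comp : ∀ {φ ψ} → 𝒜 φ → 𝒜 ψ → 𝒜 (ψ · φ)

ConverseClosed : {A : Set} → (Rel' A A → Set₁) → Set₁
ConverseClosed {A} 𝒜 = ∀ {φ} → 𝒜 φ → 𝒜 (φ °)

-- Difunctional closure of φ : the least relation of the form g° · f
-- (f, g : A → Z) containing φ, i.e. the intersection of all of them.
DifClosure : {A : Set} → Rel' A A → A → A → Set₁
DifClosure {A} φ a b =
  (Z : Set) (f g : A → Z) → φ ⊆ ((graph g) ° · graph f) → ((graph g) ° · graph f) a b

NormalRel : {A : Set} → Rel' A A → Set₁
NormalRel {A} φ = ∀ a → DifClosure φ a a

Lifting : Set → Set₂
Lifting A = {X Y : Set} → Rel' X Y → H A X → H A Y → Set₁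

record IsLaxExtension (A : Set) (L : Lifting A) : Set₂ where
  field
    mono      : {X Y : Set} {r s : Rel' X Y} → r ⊆ s → L r ⊆ L s
    graph≤    : {X Y : Set} (f : X → Y) → graphH {A} f ⊆ L (graph f)
    cograph≤  : {X Y : Set} (f : X → Y) → (graphH {A} f) ° ⊆ L ((graph f) °)
    comp≤     : {X Y Z : Set} (r : Rel' X Y) (s : Rel' Y Z) → (L s · L r) ⊆ L (s · r)

PreservesConverses : {A : Set} → Lifting A → Set₁
PreservesConverses L = {X Y : Set} (r : Rel' X Y) → L (r °) ≐ (L r) °

NormalLifting : {A : Set} → Lifting A → Set₁
NormalLifting {A} L = (X : Set) → L (1R X) ≐ 1H A X

-- The lifting  f (Ĥ r) g  iff  ∃ φ ∈ 𝒜, φ ≤ g° · r · f,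
-- written pointwise:  a φ b ⇒ f a r g b.
Ĥ : (A : Set) → (Rel' A A → Set₁) → Lifting A
Ĥ A 𝒜 r f g = Σ (Rel' A A) λ φ → 𝒜 φ × (∀ {a b} → φ a b → r (f a) (g b))

{-# OPTIONS --safe #-}
module Submission where

open import Defs
open import Data.Product using (_×_; _,_)
open import Relation.Binary.PropositionalEquality using (_≡_; refl; sym; trans)

-- Instantiate the difunctional closure of φ at the pair (f, g) itself.
normal-equalises : {A Z : Set} {φ : Rel' A A} (f g : A → Z) → NormalRel φ →
                   (∀ {a b} → φ a b → f a ≡ g b) → ∀ a → f a ≡ g a
normal-equalises {Z = Z} f g normal φ⊆ a with normal a Z f g (λ p → _ , refl , sym (φ⊆ p))
... | _ , fa≡z , ga≡z = trans fa≡z (sym ga≡z)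

module _ {A : Set} (𝒜 : Rel' A A → Set₁) where

  Ĥ-mono : {X Y : Set} {r s : Rel' X Y} → r ⊆ s → Ĥ A 𝒜 r ⊆ Ĥ A 𝒜 s
  Ĥ-mono r⊆s (φ , φ∈𝒜 , φ⊆) = φ , φ∈𝒜 , λ p → r⊆s (φ⊆ p)

  Ĥ-pointwise : 𝒜 (1R A) → {X Y : Set} (r : Rel' X Y) {u : H A X} {v : H A Y} →
                (∀ a → r (u a) (v a)) → Ĥ A 𝒜 r u v
  Ĥ-pointwise 1∈𝒜 r r-pointwise = 1R A , 1∈𝒜 , λ { refl → r-pointwise _ }

  Ĥ-comp : (∀ {φ ψ} → 𝒜 φ → 𝒜 ψ → 𝒜 (ψ · φ)) →
           {X Y Z : Set} (r : Rel' X Y) (s : Rel' Y Z) → Ĥ A 𝒜 s · Ĥ A 𝒜 r ⊆ Ĥ A 𝒜 (s · r)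
  Ĥ-comp ·∈𝒜 r s (v , (φ , φ∈𝒜 , φ⊆) , (ψ , ψ∈𝒜 , ψ⊆)) =
    ψ · φ , ·∈𝒜 φ∈𝒜 ψ∈𝒜 , λ { (b , p , q) → v b , φ⊆ p , ψ⊆ q }

  Ĥ-° : ConverseClosed 𝒜 → {X Y : Set} (r : Rel' X Y) → Ĥ A 𝒜 (r °) ⊆ (Ĥ A 𝒜 r) °
  Ĥ-° °∈𝒜 r (φ , φ∈𝒜 , φ⊆) = φ ° , °∈𝒜 φ∈𝒜 , φ⊆

  Ĥ-1R⊆1H : (∀ {φ} → 𝒜 φ → NormalRel φ) → (X : Set) → Ĥ A 𝒜 (1R X) ⊆ 1H A X
  Ĥ-1R⊆1H normal X {u} {v} (φ , φ∈𝒜 , φ⊆) = normal-equalises u v (normal φ∈𝒜) φ⊆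

theorem32 : (A : Set) (𝒜 : Rel' A A → Set₁) → IsSubmonoid 𝒜 →
    IsLaxExtension A (Ĥ A 𝒜)
    × (ConverseClosed 𝒜 → PreservesConverses (Ĥ A 𝒜))
    × ((∀ {φ} → 𝒜 φ → NormalRel φ) → NormalLifting (Ĥ A 𝒜))
theorem32 A 𝒜 submonoid = laxExtension , preservesConverses , normalLifting
  where
  open IsSubmonoid submonoid

  laxExtension : IsLaxExtension A (Ĥ A 𝒜)
  laxExtension = record
    { mono     = Ĥ-mono 𝒜
    ; graph≤   = λ f → Ĥ-pointwise 𝒜 unit (graph f)
    ; cograph≤ = λ f → Ĥ-pointwise 𝒜 unit (graph f °)
    ; comp≤    = Ĥ-comp 𝒜 comp
    }

  preservesConverses : ConverseClosed 𝒜 → PreservesConverses (Ĥ A 𝒜)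
  preservesConverses closed r = Ĥ-° 𝒜 closed r , Ĥ-° 𝒜 closed (r °)

  normalLifting : (∀ {φ} → 𝒜 φ → NormalRel φ) → NormalLifting (Ĥ A 𝒜)
  normalLifting normal X = Ĥ-1R⊆1H 𝒜 normal X , Ĥ-pointwise 𝒜 unit (1R X)
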